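{- Let $A$ and $B$ be two asynchronously composable IOTSes. (1) If $A$ and $B$ are I/O-separated and strongly synchronously compatible, then $A$ and $B$ are strongly asynchronously compatible. (2) If $A$ and $B$ are observationally I/O-separated and weakly synchronously compatible, then $A$ and $B$ are weakly asynchronously compatible.
   Context: An IOTS $A=(\mathit{states}_A,\mathit{start}_A,\mathit{act}_A,\to_A)$ has states, initial state, actions $\mathit{act}_A=\mathit{in}_A\cup\mathit{out}_A\cup\mathit{int}_A$ (disjoint union of inputs, outputs, internal actions) and transitions $s\xrightarrow{a}_A s'$. $s\ (\xrightarrow{X})^*_A\ s'$ denotes a possibly empty finite sequence of transitions labelled in $X$; $\mathit{reach}(A)$ is the set of states reachable from $\mathit{start}_A$. $A,B$ are composable if $\mathit{act}_A\cap\mathit{act}_B=(\mathit{in}_A\cap\mathit{out}_B)\cup(\mathit{in}_B\cap\mathit{out}_A)=:\mathit{shared}(A,B)$. Synchronous composition $A\otimes B$: states $\mathit{states}_A\times\mathit{states}_B$, initial $(\mathit{start}_A,\mathit{start}_B)$, inputs $(\mathit{in}_A\cup\mathit{in}_B)\setminus\mathit{shared}(A,B)$, outputs $(\mathit{out}_A\cup\mathit{out}_B)\setminus\mathit{shared}(A,B)$, internal $\mathit{int}_A\cup\mathit{int}_B\cup\mathit{shared}(A,B)$; a non-shared action of one component moves only that component; a shared action $a$ yields $(s,t)\xrightarrow{a}(s',t')$ when $s\xrightarrow{a}_A s'$ and $t\xrightarrow{a}_B t'$. For a set $M$, $M^\rhd=\{a^\rhd\mid a\in M\}$ are fresh names.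 $A,B$ are asynchronously composable if composable and $\mathit{shared}(A,B)^\rhd\cap(\mathit{act}_A\cup\mathit{act}_B)=\emptyset$. With $\mathit{out}_{AB}=\mathit{out}_A\cap\mathit{in}_B$, $\Omega(A)$ is the IOTS with states $(s,q)$, $s\in\mathit{states}_A$, $q\in\mathit{out}_{AB}^*$, initial $(\mathit{start}_A,\epsilon)$, inputs $\mathit{in}_A$, outputs $\mathit{out}_A$, internal actions $\mathit{int}_A\cup\mathit{out}_{AB}^\rhd$, and transitions $(s,q)\xrightarrow{a}(s',q)$ if $s\xrightarrow{a}_A s'$, $a\notin\mathit{out}_{AB}$; $(s,q)\xrightarrow{a^\rhd}(s',qa)$ if $s\xrightarrow{a}_A s'$, $a\in\mathit{out}_{AB}$; $(s,aq)\xrightarrow{a}(s,q)$ for $a\in\mathit{out}_{AB}$. $\Omega(B)$ analogously with $\mathit{out}_{BA}=\mathit{out}_B\cap\mathit{in}_A$. $A,B$ are strongly synchronously compatible if composable and for all $(s_A,s_B)\in\mathit{reach}(A\otimes B)$ and $a\in\mathit{out}_A\cap\mathit{in}_B$: if $s_A\xrightarrow{a}_A s_A'$ for some $s_A'$ then $s_B\xrightarrow{a}_B s_B'$ for some $s_B'$; and symmetrically for $b\in\mathit{out}_B\cap\mathit{in}_A$. Weakly synchronously compatible: same but with the conclusion $s_B\ (\xrightarrow{\mathit{int}_B})^*_B\ \bar s_B\xrightarrow{a}_B s_B'$ for some $\bar s_B,s_B'$ (symmetrically with $\mathit{int}_A$). Asynchronously composable $A,B$ are strongly (weakly) asynchronously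 compatible if $\Omega(A)$ and $\Omega(B)$ are strongly (weakly) synchronously compatible. $A$ is I/O-separated if for every $s\in\mathit{reach}(A)$ with a transition $s\xrightarrow{a}_A s'$, $a\in\mathit{out}_A$, there is no transition $s\xrightarrow{a'}_A s''$ with $a'\in\mathit{in}_A$. $A$ is observationally I/O-separated if for every $s\in\mathit{reach}(A)$ with $s\xrightarrow{a}_A s'$, $a\in\mathit{out}_A$, there is no sequence $s\ (\xrightarrow{\mathit{int}_A})^*_A\ \bar s\xrightarrow{a'}_A s''$ with $a'\in\mathit{in}_A$. -}

module Defs where

open import Data.Product using (Σ; _×_; _,_; ∃-syntax)
open import Data.Sum using (_⊎_; inj₁; inj₂)
open import Data.Empty using (⊥)
open import Data.List using (List; []; _∷_; _∷ʳ_)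
open import Relation.Nullary using (¬_)

record ATS (Act : Set) : Set₁ where
  field
    States : Set
    start  : States
    inp    : Act → Set
    out    : Act → Set
    int    : Act → Set
    _—[_]→_ : States → Act → States → Set

  act : Act → Set
  act a = inp a ⊎ out a ⊎ int a

open ATS public

record IsIOTS {Act : Set} (A : ATS Act) : Set where
  field
    inp-out-disj : ∀ a → inp A a → out A a → ⊥
    inp-int-disj : ∀ a → inp A a → int A a → ⊥
    out-int-disj : ∀ a → out A a → int A a → ⊥
    trans-act    : ∀ {s a s'} → _—[_]→_ A s a s' → act A a

IOTS : Set → Set₁
IOTS Act = Σ (ATS Act) IsIOTS

data Reach {Act : Set} (A : ATS Act) : States A → Set where
  reach-start : Reach A (start A)
  reach-step  : ∀ {s a s'} → Reach A s → _—[_]→_ A s a s' → Reach A s'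

data IntStar {Act : Set} (A : ATS Act) : States A → States A → Set where
  ε-int : ∀ {s} → IntStar A s s
  _◅-int_ : ∀ {s a s' s''} → (int A a × _—[_]→_ A s a s') →
            IntStar A s' s'' → IntStar A s s''

module _ {Act : Set} (A B : ATS Act) where

  shared : Act → Set
  shared a = (inp A a × out B a) ⊎ (inp B a × out A a)

  Composable : Set
  Composable = ∀ a → ((act A a × act B a) → shared a)
                   × (shared a → (act A a × act B a))

  data SyncStep : States A × States B → Act → States A × States B → Set where
    stepA  : ∀ {s t a s'} → _—[_]→_ A s a s' → ¬ shared a →
             SyncStep (s , t) a (s' , t)
    stepB  : ∀ {s t a t'} → _—[_]→_ B t a t' → ¬ shared a →
             SyncStep (s , t) a (s , t')
    stepAB : ∀ {s t a s' t'} → _—[_]→_ A s a s' → _—[_]→_ B t a t' → shared a →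
             SyncStep (s , t) a (s' , t')

  _⊗_ : ATS Act
  _⊗_ = record
    { States  = States A × States B
    ; start   = start A , start B
    ; inp     = λ a → (inp A a ⊎ inp B a) × ¬ shared a
    ; out     = λ a → (out A a ⊎ out B a) × ¬ shared a
    ; int     = λ a → int A a ⊎ int B a ⊎ shared a
    ; _—[_]→_ = SyncStep
    }

  StronglySyncCompatible : Set
  StronglySyncCompatible =
    Composable ×
    (∀ sA sB → Reach _⊗_ (sA , sB) →
       (∀ a → out A a → inp B a → ∀ sA' → _—[_]→_ A sA a sA' →
          ∃[ sB' ] _—[_]→_ B sB a sB')
     × (∀ b → out B b → inp A b → ∀ sB' → _—[_]→_ B sB b sB' →
          ∃[ sA' ] _—[_]→_ A sA b sA'))

  WeaklySyncCompatible : Set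
  WeaklySyncCompatible =
    Composable ×
    (∀ sA sB → Reach _⊗_ (sA , sB) →
       (∀ a → out A a → inp B a → ∀ sA' → _—[_]→_ A sA a sA' →
          ∃[ s̄B ] ∃[ sB' ] (IntStar B sB s̄B × _—[_]→_ B s̄B a sB'))
     × (∀ b → out B b → inp A b → ∀ sB' → _—[_]→_ B sB b sB' →
          ∃[ s̄A ] ∃[ sA' ] (IntStar A sA s̄A × _—[_]→_ A s̄A b sA')))

-- The fresh names a^▷ are modelled by tagging: an action a of the
-- original universe Act becomes inj₁ a, and a^▷ is inj₂ a. Thus the
-- asynchronous systems live over the action universe Act ⊎ Act and the
-- freshness requirement shared(A,B)^▷ ∩ (act_A ∪ act_B) = ∅ holds by
-- construction.

_▷ : {Act : Set} → Act → Act ⊎ Act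
a ▷ = inj₂ a

module _ {Act : Set} (A B : ATS Act) where

  outAB : Act → Set
  outAB a = out A a × inp B a

  Queue : Set
  Queue = List (Σ Act outAB)

  data ΩStep : States A × Queue → Act ⊎ Act → States A × Queue → Set where
    ω-local : ∀ {s q a s'} → _—[_]→_ A s a s' → ¬ outAB a →
              ΩStep (s , q) (inj₁ a) (s' , q)
    ω-push  : ∀ {s q a s'} → _—[_]→_ A s a s' → (p : outAB a) →
              ΩStep (s , q) (a ▷) (s' , (q ∷ʳ (a , p)))
    ω-pop   : ∀ {s q a} (p : outAB a) →
              ΩStep (s , ((a , p) ∷ q)) (inj₁ a) (s , q)

  Ω : ATS (Act ⊎ Act)
  Ω = record
    { States  = States A × Queue
    ; start   = start A , []
    ; inp     = λ { (inj₁ a) → inp A a ; (inj₂ a) → ⊥ }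
    ; out     = λ { (inj₁ a) → out A a ; (inj₂ a) → ⊥ }
    ; int     = λ { (inj₁ a) → int A a ; (inj₂ a) → outAB a }
    ; _—[_]→_ = ΩStep
    }

module _ {Act : Set} (A B : ATS Act) where

  private
    lift : (Act → Set) → (Act ⊎ Act → Set)
    lift P (inj₁ a) = P a
    lift P (inj₂ a) = ⊥

  -- A, B composable and shared(A,B)^▷ ∩ (act_A ∪ act_B) = ∅, where the
  -- latter is read in the common universe Act ⊎ Act (holds by tagging).
  AsyncComposable : Set
  AsyncComposable =
    Composable A B ×
    (∀ a → shared A B a → ¬ (lift (act A) (a ▷) ⊎ lift (act B) (a ▷)))

  StronglyAsyncCompatible : Set
  StronglyAsyncCompatible = StronglySyncCompatible (Ω A B) (Ω B A)

  WeaklyAsyncCompatible : Set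
  WeaklyAsyncCompatible = WeaklySyncCompatible (Ω A B) (Ω B A)

IOSeparated : {Act : Set} → ATS Act → Set
IOSeparated A =
  ∀ s → Reach A s → ∀ a s' → _—[_]→_ A s a s' → out A a →
    ∀ a' s'' → inp A a' → ¬ (_—[_]→_ A s a' s'')

ObsIOSeparated : {Act : Set} → ATS Act → Set
ObsIOSeparated A =
  ∀ s → Reach A s → ∀ a s' → _—[_]→_ A s a s' → out A a →
    ∀ s̄ a' s'' → inp A a' → ¬ (IntStar A s s̄ × _—[_]→_ A s̄ a' s'')

-- In a reachable state of Ω(A) ⊗ Ω(B) at most one queue is non-empty,
-- and the system owning it is merely *ahead* of a reachable state of A ⊗ B: it has
-- performed a run of unshared actions and outputs to its partner, and the queue
-- holds exactly those outputs. Both queues cannot fill at once, because a crossing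
-- of outputs in A ⊗ B would give the receiver an output and (by compatibility) an
-- input at the same state, against (observational) I/O-separation. Hence the message
-- at the head of a queue was enabled in a reachable synchronous state whose
-- receiver state is the current one, and synchronous compatibility lets the
-- receiver accept it.
module Submission where

open import Defs
open import Data.Product using (_×_; _,_; proj₁; proj₂; ∃-syntax)
open import Data.Sum using (_⊎_; inj₁; inj₂)
open import Data.Empty using (⊥; ⊥-elim)
open import Data.List using ([]; _∷_; _∷ʳ_)
open import Relation.Nullary using (¬_)
open import Relation.Binary.PropositionalEquality using (_≡_; refl)

module _ {Act : Set} {A B : ATS Act} where

  shared-sym : ∀ {a} → shared A B a → shared B A a
  shared-sym (inj₁ x) = inj₂ x
  shared-sym (inj₂ x) = inj₁ x

module _ {Act : Set} {A B : ATS Act} where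

  ⊗-step-swap : ∀ {s t a s' t'} → SyncStep A B (s , t) a (s' , t') →
                SyncStep B A (t , s) a (t' , s')
  ⊗-step-swap (stepA tA ¬sh)    = stepB tA (λ sh → ¬sh (shared-sym {A = B} {B = A} sh))
  ⊗-step-swap (stepB tB ¬sh)    = stepA tB (λ sh → ¬sh (shared-sym {A = B} {B = A} sh))
  ⊗-step-swap (stepAB tA tB sh) = stepAB tB tA (shared-sym {A = A} {B = B} sh)

  Reach-⊗-swap : ∀ {s t} → Reach (A ⊗ B) (s , t) → Reach (B ⊗ A) (t , s)
  Reach-⊗-swap reach-start      = reach-start
  Reach-⊗-swap (reach-step r σ) = reach-step (Reach-⊗-swap r) (⊗-step-swap σ)

  Reach-⊗⇒Reach₂ : ∀ {s t} → Reach (A ⊗ B) (s , t) → Reach B t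
  Reach-⊗⇒Reach₂ reach-start                    = reach-start
  Reach-⊗⇒Reach₂ (reach-step r (stepA _ _))     = Reach-⊗⇒Reach₂ r
  Reach-⊗⇒Reach₂ (reach-step r (stepB tB _))    = reach-step (Reach-⊗⇒Reach₂ r) tB
  Reach-⊗⇒Reach₂ (reach-step r (stepAB _ tB _)) = reach-step (Reach-⊗⇒Reach₂ r) tB

  IntStar-Ω : ∀ {s s' q} → (∀ a → out A a → int A a → ⊥) →
              IntStar A s s' → IntStar (Ω A B) (s , q) (s' , q)
  IntStar-Ω disj ε-int               = ε-int
  IntStar-Ω disj ((i , t) ◅-int ts) =
    (i , ω-local t (λ o → disj _ (proj₁ o) i)) ◅-int IntStar-Ω disj ts

module _ {Act : Set} (A B : ATS Act) where

  StronglyAccepts : Set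
  StronglyAccepts =
    ∀ sA sB → Reach (A ⊗ B) (sA , sB) →
      ∀ a → out A a → inp B a → ∀ sA' → _—[_]→_ A sA a sA' →
        ∃[ sB' ] _—[_]→_ B sB a sB'

  WeaklyAccepts : Set
  WeaklyAccepts =
    ∀ sA sB → Reach (A ⊗ B) (sA , sB) →
      ∀ a → out A a → inp B a → ∀ sA' → _—[_]→_ A sA a sA' →
        ∃[ s̄B ] ∃[ sB' ] (IntStar B sB s̄B × _—[_]→_ B s̄B a sB')

  NoCrossingOutputs : Set
  NoCrossingOutputs =
    ∀ {sA sB a b sA' sB'} → Reach (A ⊗ B) (sA , sB) →
      outAB A B a → _—[_]→_ A sA a sA' → outAB B A b → _—[_]→_ B sB b sB' → ⊥

  data BufferedRun : States A → Queue A B → States A → Set where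
    run-ε      : ∀ {s} → BufferedRun s [] s
    run-local  : ∀ {s x s' q s''} → _—[_]→_ A s x s' → ¬ shared A B x →
                 BufferedRun s' q s'' → BufferedRun s q s''
    run-output : ∀ {s a s' q s''} → _—[_]→_ A s a s' → (p : outAB A B a) →
                 BufferedRun s' q s'' → BufferedRun s ((a , p) ∷ q) s''

  BufferedRun-local : ∀ {s q s' x s''} → BufferedRun s q s' → _—[_]→_ A s' x s'' →
                      ¬ shared A B x → BufferedRun s q s''
  BufferedRun-local run-ε               t ¬sh = run-local t ¬sh run-ε
  BufferedRun-local (run-local u ¬u ρ)  t ¬sh = run-local u ¬u (BufferedRun-local ρ t ¬sh)
  BufferedRun-local (run-output u p ρ)  t ¬sh = run-output u p (BufferedRun-local ρ t ¬sh)

  BufferedRun-output : ∀ {s q s' a s''} → BufferedRun s q s' → _—[_]→_ A s' a s'' →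
                       (p : outAB A B a) → BufferedRun s (q ∷ʳ (a , p)) s''
  BufferedRun-output run-ε              t p = run-output t p run-ε
  BufferedRun-output (run-local u ¬u ρ) t p = run-local u ¬u (BufferedRun-output ρ t p)
  BufferedRun-output (run-output u p' ρ) t p = run-output u p' (BufferedRun-output ρ t p)

  BufferedRun-[]-absorb : ∀ {s₀ sA sB} → Reach (A ⊗ B) (s₀ , sB) →
                          BufferedRun s₀ [] sA → Reach (A ⊗ B) (sA , sB)
  BufferedRun-[]-absorb r run-ε              = r
  BufferedRun-[]-absorb r (run-local t ¬sh ρ) =
    BufferedRun-[]-absorb (reach-step r (stepA t ¬sh)) ρ

  BufferedRun-∷-absorb : ∀ {s₀ sA sB a p q} → Reach (A ⊗ B) (s₀ , sB) →
    BufferedRun s₀ ((a , p) ∷ q) sA →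
    ∃[ s ] ∃[ s' ] (Reach (A ⊗ B) (s , sB) × _—[_]→_ A s a s' × BufferedRun s' q sA)
  BufferedRun-∷-absorb r (run-local t ¬sh ρ) =
    BufferedRun-∷-absorb (reach-step r (stepA t ¬sh)) ρ
  BufferedRun-∷-absorb r (run-output t _ ρ)  = _ , _ , r , t , ρ

  Ahead : States A → Queue A B → States B → Set
  Ahead sA q sB = ∃[ s₀ ] (Reach (A ⊗ B) (s₀ , sB) × BufferedRun s₀ q sA)

  Ahead-[] : ∀ {sA sB} → Reach (A ⊗ B) (sA , sB) → Ahead sA [] sB
  Ahead-[] r = _ , r , run-ε

  Ahead-[]⇒Reach : ∀ {sA sB} → Ahead sA [] sB → Reach (A ⊗ B) (sA , sB)
  Ahead-[]⇒Reach (_ , r , ρ) = BufferedRun-[]-absorb r ρ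

  Ahead-local₁ : ∀ {sA q sB x sA'} → Ahead sA q sB → _—[_]→_ A sA x sA' →
                 ¬ shared A B x → Ahead sA' q sB
  Ahead-local₁ (s₀ , r , ρ) t ¬sh = s₀ , r , BufferedRun-local ρ t ¬sh

  Ahead-output₁ : ∀ {sA q sB a sA'} → Ahead sA q sB → _—[_]→_ A sA a sA' →
                  (p : outAB A B a) → Ahead sA' (q ∷ʳ (a , p)) sB
  Ahead-output₁ (s₀ , r , ρ) t p = s₀ , r , BufferedRun-output ρ t p

  Ahead-local₂ : ∀ {sA q sB y sB'} → Ahead sA q sB → _—[_]→_ B sB y sB' →
                 ¬ shared A B y → Ahead sA q sB'
  Ahead-local₂ (s₀ , r , ρ) t ¬sh = s₀ , reach-step r (stepB t ¬sh) , ρ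

  Ahead-head-enabled : ∀ {sA a p q sB} → Ahead sA ((a , p) ∷ q) sB →
    ∃[ s ] ∃[ s' ] (Reach (A ⊗ B) (s , sB) × _—[_]→_ A s a s')
  Ahead-head-enabled (_ , r , ρ) with BufferedRun-∷-absorb r ρ
  ... | s , s' , r' , t , _ = s , s' , r' , t

  Ahead-consume₂ : ∀ {sA a p q sB sB'} → Ahead sA ((a , p) ∷ q) sB →
                   _—[_]→_ B sB a sB' → Ahead sA q sB'
  Ahead-consume₂ {p = o , i} (_ , r , ρ) tB with BufferedRun-∷-absorb r ρ
  ... | _ , _ , r' , t , ρ' = _ , reach-step r' (stepAB t tB (inj₂ (i , o))) , ρ'

module _ {Act : Set} (A B : ATS Act) where

  OneAhead : States (Ω A B) × States (Ω B A) → Set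
  OneAhead ((sA , qA) , (sB , qB)) =
    (qB ≡ [] × Ahead A B sA qA sB) ⊎ (qA ≡ [] × Ahead B A sB qB sA)

module _ {Act : Set} {A B : ATS Act} (noCrossing : NoCrossingOutputs A B) where

  private
    OneAhead-output₁ : ∀ {sA sA' sB qB a} → Ahead B A sB qB sA → _—[_]→_ A sA a sA' →
                       (p : outAB A B a) → OneAhead A B ((sA' , [] ∷ʳ (a , p)) , (sB , qB))
    OneAhead-output₁ {qB = []} h t p =
      inj₁ (refl , Ahead-output₁ A B (Ahead-[] A B (Reach-⊗-swap (Ahead-[]⇒Reach B A h))) t p)
    OneAhead-output₁ {qB = (_ , pb) ∷ _} h t p with Ahead-head-enabled B A h
    ... | _ , _ , r , tB = ⊥-elim (noCrossing (Reach-⊗-swap r) p t pb tB)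

    OneAhead-output₂ : ∀ {sA sB sB' qA b} → Ahead A B sA qA sB → _—[_]→_ B sB b sB' →
                       (p : outAB B A b) → OneAhead A B ((sA , qA) , (sB' , [] ∷ʳ (b , p)))
    OneAhead-output₂ {qA = []} h t p =
      inj₂ (refl , Ahead-output₁ B A (Ahead-[] B A (Reach-⊗-swap (Ahead-[]⇒Reach A B h))) t p)
    OneAhead-output₂ {qA = (_ , pa) ∷ _} h t p with Ahead-head-enabled A B h
    ... | _ , _ , r , tA = ⊥-elim (noCrossing r pa tA p t)

  OneAhead-step : ∀ {x a y} → OneAhead A B x →
                  SyncStep (Ω A B) (Ω B A) x a y → OneAhead A B y
  OneAhead-step (inj₁ (refl , h)) (stepA (ω-local t _) ¬sh) = inj₁ (refl , Ahead-local₁ A B h t ¬sh)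
  OneAhead-step (inj₁ (refl , h)) (stepA (ω-push t p) _)    = inj₁ (refl , Ahead-output₁ A B h t p)
  OneAhead-step (inj₂ (refl , h)) (stepA (ω-local t _) ¬sh) =
    inj₂ (refl , Ahead-local₂ B A h t (λ sh → ¬sh (shared-sym {A = B} {B = A} sh)))
  OneAhead-step (inj₂ (refl , h)) (stepA (ω-push t p) _)    = OneAhead-output₁ h t p
  OneAhead-step _ (stepA (ω-pop (o , i)) ¬sh)                = ⊥-elim (¬sh (inj₂ (i , o)))
  OneAhead-step (inj₁ (refl , h)) (stepB (ω-local t _) ¬sh) = inj₁ (refl , Ahead-local₂ A B h t ¬sh)
  OneAhead-step (inj₁ (refl , h)) (stepB (ω-push t p) _)    = OneAhead-output₂ h t p
  OneAhead-step (inj₂ (refl , h)) (stepB (ω-local t _) ¬sh) =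
    inj₂ (refl , Ahead-local₁ B A h t (λ sh → ¬sh (shared-sym {A = B} {B = A} sh)))
  OneAhead-step (inj₂ (refl , h)) (stepB (ω-push t p) _)    = inj₂ (refl , Ahead-output₁ B A h t p)
  OneAhead-step _ (stepB (ω-pop (o , i)) ¬sh)                = ⊥-elim (¬sh (inj₁ (i , o)))
  OneAhead-step (inj₁ (refl , h)) (stepAB (ω-pop _) (ω-local tB _) _) =
    inj₁ (refl , Ahead-consume₂ A B h tB)
  OneAhead-step (inj₂ (refl , h)) (stepAB (ω-local tA _) (ω-pop _) _) =
    inj₂ (refl , Ahead-consume₂ B A h tA)
  OneAhead-step _ (stepAB (ω-local _ _) (ω-local _ ¬o) (inj₁ (i , o))) = ⊥-elim (¬o (o , i))
  OneAhead-step _ (stepAB (ω-local _ ¬o) (ω-local _ _) (inj₂ (i , o))) = ⊥-elim (¬o (o , i))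
  OneAhead-step _ (stepAB (ω-push _ _) (ω-push _ _) (inj₁ (() , _)))
  OneAhead-step _ (stepAB (ω-push _ _) (ω-push _ _) (inj₂ (() , _)))

  Reach-Ω⊗Ω⇒OneAhead : ∀ {x} → Reach (Ω A B ⊗ Ω B A) x → OneAhead A B x
  Reach-Ω⊗Ω⇒OneAhead reach-start      = inj₁ (refl , Ahead-[] A B reach-start)
  Reach-Ω⊗Ω⇒OneAhead (reach-step r σ) = OneAhead-step (Reach-Ω⊗Ω⇒OneAhead r) σ

  queue-head-enabled : ∀ {sA a p q sB qB} →
    Reach (Ω A B ⊗ Ω B A) ((sA , (a , p) ∷ q) , (sB , qB)) →
    ∃[ s ] ∃[ s' ] (Reach (A ⊗ B) (s , sB) × _—[_]→_ A s a s')
  queue-head-enabled r with Reach-Ω⊗Ω⇒OneAhead r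
  ... | inj₁ (_ , h) = Ahead-head-enabled A B h
  ... | inj₂ (() , _)

module _ {Act : Set} {A B : ATS Act} where

  StronglySyncCompatible⇒Accepts₁ : StronglySyncCompatible A B → StronglyAccepts A B
  StronglySyncCompatible⇒Accepts₁ (_ , compatible) sA sB r = proj₁ (compatible sA sB r)

  StronglySyncCompatible⇒Accepts₂ : StronglySyncCompatible A B → StronglyAccepts B A
  StronglySyncCompatible⇒Accepts₂ (_ , compatible) sB sA r =
    proj₂ (compatible sA sB (Reach-⊗-swap r))

  StronglyAccepts⇒StronglySyncCompatible : Composable A B →
    StronglyAccepts A B → StronglyAccepts B A → StronglySyncCompatible A B
  StronglyAccepts⇒StronglySyncCompatible composable accAB accBA =
    composable , λ sA sB r → accAB sA sB r , accBA sB sA (Reach-⊗-swap r)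

  WeaklySyncCompatible⇒Accepts₁ : WeaklySyncCompatible A B → WeaklyAccepts A B
  WeaklySyncCompatible⇒Accepts₁ (_ , compatible) sA sB r = proj₁ (compatible sA sB r)

  WeaklySyncCompatible⇒Accepts₂ : WeaklySyncCompatible A B → WeaklyAccepts B A
  WeaklySyncCompatible⇒Accepts₂ (_ , compatible) sB sA r =
    proj₂ (compatible sA sB (Reach-⊗-swap r))

  WeaklyAccepts⇒WeaklySyncCompatible : Composable A B →
    WeaklyAccepts A B → WeaklyAccepts B A → WeaklySyncCompatible A B
  WeaklyAccepts⇒WeaklySyncCompatible composable accAB accBA =
    composable , λ sA sB r → accAB sA sB r , accBA sB sA (Reach-⊗-swap r)

  IOSeparated⇒NoCrossingOutputs : IOSeparated B → StronglyAccepts A B →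
                                  NoCrossingOutputs A B
  IOSeparated⇒NoCrossingOutputs sepB accepts r (oA , iB) tA (oB , _) tB
    with accepts _ _ r _ oA iB _ tA
  ... | _ , tB' = sepB _ (Reach-⊗⇒Reach₂ r) _ _ tB oB _ _ iB tB'

  ObsIOSeparated⇒NoCrossingOutputs : ObsIOSeparated B → WeaklyAccepts A B →
                                     NoCrossingOutputs A B
  ObsIOSeparated⇒NoCrossingOutputs sepB accepts r (oA , iB) tA (oB , _) tB
    with accepts _ _ r _ oA iB _ tA
  ... | _ , _ , internal , tB' = sepB _ (Reach-⊗⇒Reach₂ r) _ _ tB oB _ _ _ iB (internal , tB')

  Ω-composable : IsIOTS B → Composable A B → Composable (Ω A B) (Ω B A)
  Ω-composable isB composable (inj₁ a) = composable a
  Ω-composable isB composable (inj₂ a) = bothΩ⇒shared , λ { (inj₁ (() , _)) ; (inj₂ (() , _)) }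
    where
    bothΩ⇒shared : act (Ω A B) (a ▷) × act (Ω B A) (a ▷) → shared (Ω A B) (Ω B A) (a ▷)
    bothΩ⇒shared (inj₂ (inj₂ (_ , iB)) , inj₂ (inj₂ (oB , _))) =
      ⊥-elim (IsIOTS.inp-out-disj isB a iB oB)

  inp⇒¬outAB : IsIOTS B → ∀ {a} → inp B a → ¬ outAB B A a
  inp⇒¬outAB isB i (o , _) = IsIOTS.inp-out-disj isB _ i o

  Ω-StronglyAccepts : IsIOTS B → IOSeparated B → StronglyAccepts A B →
                      StronglyAccepts (Ω A B) (Ω B A)
  Ω-StronglyAccepts isB sepB accepts _ _ r (inj₁ a) o i _ (ω-local _ ¬o) = ⊥-elim (¬o (o , i))
  Ω-StronglyAccepts isB sepB accepts _ (sB , qB) r (inj₁ a) o i _ (ω-pop _)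
    with queue-head-enabled (IOSeparated⇒NoCrossingOutputs sepB accepts) r
  ... | s , s' , r' , t with accepts s sB r' a o i s' t
  ... | sB' , tB = (sB' , qB) , ω-local tB (inp⇒¬outAB isB i)

  Ω-WeaklyAccepts : IsIOTS B → ObsIOSeparated B → WeaklyAccepts A B →
                    WeaklyAccepts (Ω A B) (Ω B A)
  Ω-WeaklyAccepts isB sepB accepts _ _ r (inj₁ a) o i _ (ω-local _ ¬o) = ⊥-elim (¬o (o , i))
  Ω-WeaklyAccepts isB sepB accepts _ (sB , qB) r (inj₁ a) o i _ (ω-pop _)
    with queue-head-enabled (ObsIOSeparated⇒NoCrossingOutputs sepB accepts) r
  ... | s , s' , r' , t with accepts s sB r' a o i s' t
  ... | s̄B , sB' , internal , tB =
    (s̄B , qB) , (sB' , qB) , IntStar-Ω (IsIOTS.out-int-disj isB) internal ,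
    ω-local tB (inp⇒¬outAB isB i)

corollary4p6 : {Act : Set} (A B : IOTS Act) →
    AsyncComposable (proj₁ A) (proj₁ B) →
    ((IOSeparated (proj₁ A) × IOSeparated (proj₁ B) ×
    StronglySyncCompatible (proj₁ A) (proj₁ B)) →
    StronglyAsyncCompatible (proj₁ A) (proj₁ B))
    × ((ObsIOSeparated (proj₁ A) × ObsIOSeparated (proj₁ B) ×
    WeaklySyncCompatible (proj₁ A) (proj₁ B)) →
    WeaklyAsyncCompatible (proj₁ A) (proj₁ B))
corollary4p6 (A , isA) (B , isB) (composable , _) =
  (λ (sepA , sepB , compatible) →
     StronglyAccepts⇒StronglySyncCompatible (Ω-composable isB composable)
       (Ω-StronglyAccepts isB sepB (StronglySyncCompatible⇒Accepts₁ compatible))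
       (Ω-StronglyAccepts isA sepA (StronglySyncCompatible⇒Accepts₂ compatible))) ,
  (λ (sepA , sepB , compatible) →
     WeaklyAccepts⇒WeaklySyncCompatible (Ω-composable isB composable)
       (Ω-WeaklyAccepts isB sepB (WeaklySyncCompatible⇒Accepts₁ compatible))
       (Ω-WeaklyAccepts isA sepA (WeaklySyncCompatible⇒Accepts₂ compatible)))
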